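{- Let $j\ge 1$, $\lambda\ge 1$, $s\ge 0$ be integers, let $w=w_{j,s,\lambda}$ be the leaf weight sequence of the labeled tree $\mathcal K$ described in the context, and put $N_0=3+2s+\lambda j$. Let $g=g_{j,s,\lambda}$ be the sequence generated by the recursion $$g(n)=g\bigl(n-s-g(n-j)\bigr)+\lambda j \qquad (n>N_0)$$ with initial conditions $g(n)=w(n)$ for $1\le n\le N_0$. Then $g(n)=w(n)$ for every positive integer $n$.
   Context: Construction of the labeled tree $\mathcal K$ (parameters $j\ge1,\lambda\ge1,s\ge0$). There are "supernodes" $S_0,S_1,S_2,\dots$ with an edge $S_i$–$S_{i+1}$ for every $i\ge0$; $S_0$ is the root. $S_0$ has two further children: the "initial leaf" $L_*$ and a node $L_0$ which is a leaf of $\mathcal K$. For each $i\ge1$, $S_i$ has one further child, the "knot node" $N_i$, and below $N_i$ hang $\lambda$ chains (paths), each consisting of $ij$ nodes, the top node of each chain being a child of $N_i$; the bottom node of each such chain is a leaf of $\mathcal K$. (So the subtree $\mathcal K_0$ is $S_0$–$L_0$, and $\mathcal K_i$, $i\ge1$, consists of $S_i$, $N_i$ and its $\lambda$ chains.) Labels: each supernode receives $s$ labels and every other node receives exactly one label; the labels are the consecutive positive integers $1,2,3,\dots$ assigned in the following order: $L_*$, then $S_0$ ($s$ labels), then $L_0$, then for $i=1,2,\dots$: $S_i$ ($s$ labels), then $N_i$, then the $\lambda$ chains below $N_i$ one after another (left to right), each chain traversed from its top node down to its bottom leaf. Weights: $L_*$ has weight $1$, and every other leaf of $\mathcal K$ ($L_0$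 and the bottom nodes of all chains) has weight $j$. The leaf weight sequence $w_{j,s,\lambda}(n)$ is the sum of the weights of the leaves of $\mathcal K$ whose label is $\le n$. (For example, for $j=2,\lambda=3,s=4$ it begins $1,1,1,1,1,3,3,3,3,3,3,3,5,5,7,7,9,\dots$.) -}

module Defs where

open import Data.Nat using (ℕ; zero; suc; _+_; _*_; _∸_)
open import Data.List using (List; []; _∷_; _++_; replicate; concat; take; map; applyUpTo)
open import Data.Nat.ListAction using (sum)

-- Kinds of nodes of the tree 𝒦, listed per label (a supernode contributes s labels,
-- every other node exactly one label).
data NodeKind : Set where
  initialLeaf : NodeKind
  supernode   : NodeKind
  leafL0      : NodeKind
  knot        : NodeKind
  chainInner  : NodeKind
  chainBottom : NodeKind

labelWeight : ℕ → NodeKind → ℕ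
labelWeight j initialLeaf = 1
labelWeight j supernode   = 0
labelWeight j leafL0      = j
labelWeight j knot        = 0
labelWeight j chainInner  = 0
labelWeight j chainBottom = j

chain : ℕ → List NodeKind
chain zero    = []
chain (suc k) = replicate k chainInner ++ (chainBottom ∷ [])

labels0 : (s : ℕ) → List NodeKind
labels0 s = initialLeaf ∷ replicate s supernode ++ (leafL0 ∷ [])

-- labels of 𝒦_i (i ≥ 1): S_i (s labels), N_i, then λ chains of i·j nodes each
labelsBlock : (j s λ' i : ℕ) → List NodeKind
labelsBlock j s λ' i = replicate s supernode ++ (knot ∷ concat (replicate λ' (chain (i * j))))

-- the node kinds carried by labels 1,2,…,m (in order), where m is large enough to cover
-- labels 1..n (each block 𝒦_i, i ≥ 1, has at least one label, so blocks 1..n suffice)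
labelsUpTo : (j s λ' n : ℕ) → List NodeKind
labelsUpTo j s λ' n = labels0 s ++ concat (applyUpTo (λ i → labelsBlock j s λ' (suc i)) n)

w : (j s λ' n : ℕ) → ℕ
w j s λ' n = sum (map (labelWeight j) (take n (labelsUpTo j s λ' n)))

N₀ : (j s λ' : ℕ) → ℕ
N₀ j s λ' = 3 + 2 * s + λ' * j

-- Cut the positions n ≥ s + 2 into zones, the maximal runs on which w is constant: a zone starts
-- at every leaf of weight j, so the λ zones met in 𝒦_(a+1) carry the values 1 + (a λ + c + 1) j.
-- Going from 𝒦_(a+1) to 𝒦_(a+2) lengthens every chain, hence every zone, by exactly j, and this is
-- what makes n ↦ n - s - w(n - j) map zone c of 𝒦_(a+2) onto zone c of 𝒦_(a+1), where w is
-- smaller by λ j.  As zones are at least j long, n - j lies in the zone of n or in the one before,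
-- which determines w(n - j).  So w satisfies the recursion with all arguments in [1, n), and the
-- recursion together with the initial values forces g = w by strong induction.

module Submission where

open import Data.Empty using (⊥-elim)
open import Data.List using (List; []; _∷_; _++_; [_]; replicate; concat; take; map; applyUpTo; length)
open import Data.List.Properties
  using (length-++; length-replicate; ++-identityʳ; map-++; applyUpTo-∷ʳ; concat-++)
open import Data.Nat using (ℕ; zero; suc; _+_; _*_; _∸_; _≤_; _<_; z≤n; s≤s; _≤?_)
open import Data.Nat.Induction using (<-rec)
open import Data.Nat.ListAction using (sum)
open import Data.Nat.ListAction.Properties using (sum-++)
open import Data.Nat.Properties
open import Data.Nat.Tactic.RingSolver using (solve-∀)
open import Data.Product using (_×_; _,_; ∃-syntax)
open import Relation.Binary.PropositionalEquality
  using (_≡_; refl; sym; trans; cong; cong₂; subst; subst₂; module ≡-Reasoning)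
open import Relation.Nullary using (yes; no)

open import Defs

open ≡-Reasoning

module PrefixWeight {A : Set} (weight : A → ℕ) where

  totalWeight : List A → ℕ
  totalWeight xs = sum (map weight xs)

  prefixWeight : List A → ℕ → ℕ
  prefixWeight xs n = totalWeight (take n xs)

  totalWeight-++ : ∀ xs ys → totalWeight (xs ++ ys) ≡ totalWeight xs + totalWeight ys
  totalWeight-++ xs ys = trans (cong sum (map-++ weight xs ys)) (sum-++ (map weight xs) (map weight ys))

  totalWeight-replicate-++ : ∀ k x ys →
    totalWeight (replicate k x ++ ys) ≡ k * weight x + totalWeight ys
  totalWeight-replicate-++ zero    x ys = refl
  totalWeight-replicate-++ (suc k) x ys =
    trans (cong (weight x +_) (totalWeight-replicate-++ k x ys)) (sym (+-assoc (weight x) _ _))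

  totalWeight-concat-replicate : ∀ k xs → totalWeight (concat (replicate k xs)) ≡ k * totalWeight xs
  totalWeight-concat-replicate zero    xs = refl
  totalWeight-concat-replicate (suc k) xs =
    trans (totalWeight-++ xs _) (cong (totalWeight xs +_) (totalWeight-concat-replicate k xs))

  prefixWeight-++ˡ : ∀ xs ys {n} → n ≤ length xs → prefixWeight (xs ++ ys) n ≡ prefixWeight xs n
  prefixWeight-++ˡ xs       ys {zero}  _        = refl
  prefixWeight-++ˡ (x ∷ xs) ys {suc n} (s≤s n≤) = cong (weight x +_) (prefixWeight-++ˡ xs ys n≤)

  prefixWeight-++ʳ : ∀ xs ys n →
    prefixWeight (xs ++ ys) (length xs + n) ≡ totalWeight xs + prefixWeight ys n
  prefixWeight-++ʳ []       ys n = refl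
  prefixWeight-++ʳ (x ∷ xs) ys n =
    trans (cong (weight x +_) (prefixWeight-++ʳ xs ys n)) (sym (+-assoc (weight x) _ _))

  prefixWeight-replicate-++ˡ : ∀ k x ys {n} → n ≤ k →
    prefixWeight (replicate k x ++ ys) n ≡ n * weight x
  prefixWeight-replicate-++ˡ k       x ys {zero}  _         = refl
  prefixWeight-replicate-++ˡ (suc k) x ys {suc n} (s≤s n≤k) =
    cong (weight x +_) (prefixWeight-replicate-++ˡ k x ys n≤k)

  prefixWeight-replicate-++ʳ : ∀ k x ys n →
    prefixWeight (replicate k x ++ ys) (k + n) ≡ k * weight x + prefixWeight ys n
  prefixWeight-replicate-++ʳ zero    x ys n = refl
  prefixWeight-replicate-++ʳ (suc k) x ys n =
    trans (cong (weight x +_) (prefixWeight-replicate-++ʳ k x ys n)) (sym (+-assoc (weight x) _ _))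

  prefixWeight-concat-replicate : ∀ xs {k c r} → c < k → r ≤ length xs →
    prefixWeight (concat (replicate k xs)) (c * length xs + r) ≡ c * totalWeight xs + prefixWeight xs r
  prefixWeight-concat-replicate xs {suc k} {zero}      _          r≤ = prefixWeight-++ˡ xs _ r≤
  prefixWeight-concat-replicate xs {suc k} {suc c} {r} (s≤s c<k) r≤ = begin
    prefixWeight (xs ++ rest) (length xs + c * length xs + r)
      ≡⟨ cong (prefixWeight (xs ++ rest)) (+-assoc (length xs) (c * length xs) r) ⟩
    prefixWeight (xs ++ rest) (length xs + (c * length xs + r))
      ≡⟨ prefixWeight-++ʳ xs rest (c * length xs + r) ⟩
    totalWeight xs + prefixWeight rest (c * length xs + r)
      ≡⟨ cong (totalWeight xs +_) (prefixWeight-concat-replicate xs c<k r≤) ⟩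
    totalWeight xs + (c * totalWeight xs + prefixWeight xs r)
      ≡⟨ +-assoc (totalWeight xs) (c * totalWeight xs) (prefixWeight xs r) ⟨
    totalWeight xs + c * totalWeight xs + prefixWeight xs r ∎
    where
    rest = concat (replicate k xs)

  prefixWeight-concat-applyUpTo : ∀ (f : ℕ → List A) {N a t} → a < N → t ≤ length (f a) →
    prefixWeight (concat (applyUpTo f N)) (length (concat (applyUpTo f a)) + t)
      ≡ totalWeight (concat (applyUpTo f a)) + prefixWeight (f a) t
  prefixWeight-concat-applyUpTo f {suc N} {zero}      _          t≤ = prefixWeight-++ˡ (f 0) _ t≤
  prefixWeight-concat-applyUpTo f {suc N} {suc a} {t} (s≤s a<N) t≤ = begin
    prefixWeight (f 0 ++ rest N) (length (f 0 ++ rest a) + t)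
      ≡⟨ cong (prefixWeight (f 0 ++ rest N))
           (trans (cong (_+ t) (length-++ (f 0))) (+-assoc (length (f 0)) (length (rest a)) t)) ⟩
    prefixWeight (f 0 ++ rest N) (length (f 0) + (length (rest a) + t))
      ≡⟨ prefixWeight-++ʳ (f 0) (rest N) (length (rest a) + t) ⟩
    totalWeight (f 0) + prefixWeight (rest N) (length (rest a) + t)
      ≡⟨ cong (totalWeight (f 0) +_) (prefixWeight-concat-applyUpTo (λ i → f (suc i)) a<N t≤) ⟩
    totalWeight (f 0) + (totalWeight (rest a) + prefixWeight (f (suc a)) t)
      ≡⟨ +-assoc (totalWeight (f 0)) (totalWeight (rest a)) _ ⟨
    totalWeight (f 0) + totalWeight (rest a) + prefixWeight (f (suc a)) t
      ≡⟨ cong (_+ prefixWeight (f (suc a)) t) (totalWeight-++ (f 0) (rest a)) ⟨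
    totalWeight (f 0 ++ rest a) + prefixWeight (f (suc a)) t ∎
    where
    rest : ℕ → List A
    rest n = concat (applyUpTo (λ i → f (suc i)) n)

length-concat-replicate : ∀ {A : Set} k (xs : List A) → length (concat (replicate k xs)) ≡ k * length xs
length-concat-replicate zero    xs = refl
length-concat-replicate (suc k) xs = trans (length-++ xs) (cong (length xs +_) (length-concat-replicate k xs))

concat-applyUpTo-suc : ∀ {A : Set} (f : ℕ → List A) n →
  concat (applyUpTo f (suc n)) ≡ concat (applyUpTo f n) ++ f n
concat-applyUpTo-suc f n = begin
  concat (applyUpTo f (suc n))          ≡⟨ cong concat (applyUpTo-∷ʳ f n) ⟨
  concat (applyUpTo f n ++ [ f n ])     ≡⟨ concat-++ (applyUpTo f n) [ f n ] ⟨
  concat (applyUpTo f n) ++ (f n ++ []) ≡⟨ cong (concat (applyUpTo f n) ++_) (++-identityʳ (f n)) ⟩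
  concat (applyUpTo f n) ++ f n         ∎

bracketing : ∀ (P : ℕ → ℕ) N {n} → P 0 ≤ n → n < P N →
  ∃[ k ] (k < N × P k ≤ n × n < P (suc k))
bracketing P zero    P0≤n n<P0 = ⊥-elim (<⇒≱ n<P0 P0≤n)
bracketing P (suc N) {n} P0≤n n<PN with P N ≤? n
... | yes PN≤n = N , n<1+n N , PN≤n , n<PN
... | no  PN≰n with bracketing P N P0≤n (≰⇒> PN≰n)
...   | k , k<N , Pk≤n , n<Pk+1 = k , m<n⇒m<1+n k<N , Pk≤n , n<Pk+1

nestedRecursion-unique : ∀ {j s c N₀} (g h : ℕ → ℕ) → 1 ≤ j → j ≤ N₀ →
  (∀ n → 1 ≤ n → 1 ≤ h n) →
  (∀ n → N₀ < n → s + h (n ∸ j) < n) →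
  (∀ n → 1 ≤ n → n ≤ N₀ → g n ≡ h n) →
  (∀ n → N₀ < n → g n ≡ g (n ∸ s ∸ g (n ∸ j)) + c) →
  (∀ n → N₀ < n → h n ≡ h (n ∸ s ∸ h (n ∸ j)) + c) →
  ∀ n → 1 ≤ n → g n ≡ h n
nestedRecursion-unique {j} {s} {c} {N₀} g h 1≤j j≤N₀ h-positive h-argument< g≡h-initially
                       g-rec h-rec =
  <-rec (λ n → 1 ≤ n → g n ≡ h n) agree
  where
  agree : ∀ n → (∀ {m} → m < n → 1 ≤ m → g m ≡ h m) → 1 ≤ n → g n ≡ h n
  agree n ih 1≤n with n ≤? N₀
  ... | yes n≤N₀ = g≡h-initially n 1≤n n≤N₀
  ... | no  n≰N₀ = begin
    g n                           ≡⟨ g-rec n N₀<n ⟩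
    g (n ∸ s ∸ g (n ∸ j)) + c     ≡⟨ cong (λ y → g (n ∸ s ∸ y) + c) (ih n∸j<n 1≤n∸j) ⟩
    g (n ∸ s ∸ h (n ∸ j)) + c     ≡⟨ cong (_+ c) (ih argument<n 1≤argument) ⟩
    h (n ∸ s ∸ h (n ∸ j)) + c     ≡⟨ h-rec n N₀<n ⟨
    h n                           ∎
    where
    N₀<n : N₀ < n
    N₀<n = ≰⇒> n≰N₀
    j<n : j < n
    j<n = ≤-<-trans j≤N₀ N₀<n
    n∸j<n : n ∸ j < n
    n∸j<n = ∸-monoʳ-< 1≤j (<⇒≤ j<n)
    1≤n∸j : 1 ≤ n ∸ j
    1≤n∸j = m<n⇒0<n∸m j<n
    shift<n : s + h (n ∸ j) < n
    shift<n = h-argument< n N₀<n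
    argument<n : n ∸ s ∸ h (n ∸ j) < n
    argument<n = subst (_< n) (sym (∸-+-assoc n s (h (n ∸ j))))
      (∸-monoʳ-< (≤-trans (h-positive (n ∸ j) 1≤n∸j) (m≤n+m _ s)) (<⇒≤ shift<n))
    1≤argument : 1 ≤ n ∸ s ∸ h (n ∸ j)
    1≤argument = subst (1 ≤_) (sym (∸-+-assoc n s (h (n ∸ j)))) (m<n⇒0<n∸m shift<n)

w-positive : ∀ j s λ' n → 1 ≤ n → 1 ≤ w j s λ' n
w-positive j s λ' (suc n) _ = s≤s z≤n

module Tree (j-1 s λ-1 : ℕ) where

  j λ' : ℕ
  j  = suc j-1
  λ' = suc λ-1

  open PrefixWeight (labelWeight j)

  chainLength : ℕ → ℕ
  chainLength a = suc a * j

  block : ℕ → List NodeKind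
  block a = labelsBlock j s λ' (suc a)

  blocks : ℕ → List NodeKind
  blocks a = concat (applyUpTo block a)

  -- Positions count labels from 1, so w n is the weight of the first n labels; block a is
  -- 𝒦_(a+1), whose labels are blockStart a + 1, blockStart a + 2, ….  Zone (a , c), c < λ', is
  -- [zoneStart a c , zoneStart a (suc c)): it starts at the leaf closing chain c - 1 of block a,
  -- or for c = 0 at the leaf just before block a.
  zoneOffset : ℕ → ℕ → ℕ
  zoneOffset a zero    = 0
  zoneOffset a (suc c) = s + suc (suc c * chainLength a)

  blockStart : ℕ → ℕ
  blockStart zero    = s + 2
  blockStart (suc a) = blockStart a + zoneOffset a λ'

  zoneStart : ℕ → ℕ → ℕ
  zoneStart a c = blockStart a + zoneOffset a c

  zoneLength : ℕ → ℕ → ℕ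
  zoneLength a zero    = s + suc (chainLength a)
  zoneLength a (suc c) = chainLength a

  zoneValue : ℕ → ℕ → ℕ
  zoneValue a c = suc (suc (a * λ' + c) * j)

  zoneOffset-suc : ∀ a c → zoneOffset a (suc c) ≡ zoneOffset a c + zoneLength a c
  zoneOffset-suc a zero    = cong (λ m → s + suc m) (+-identityʳ (chainLength a))
  zoneOffset-suc a (suc c) = identity s (suc c * chainLength a) (chainLength a)
    where
    identity : ∀ s x m → s + suc (m + x) ≡ s + suc x + m
    identity = solve-∀

  zoneStart-suc : ∀ a c → zoneStart a (suc c) ≡ zoneStart a c + zoneLength a c
  zoneStart-suc a c =
    trans (cong (blockStart a +_) (zoneOffset-suc a c)) (sym (+-assoc (blockStart a) _ _))

  zoneStart-last : ∀ a → zoneStart a λ' ≡ zoneStart (suc a) 0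
  zoneStart-last a = sym (+-identityʳ (blockStart (suc a)))

  zoneLength-suc : ∀ a c → zoneLength (suc a) c ≡ zoneLength a c + j
  zoneLength-suc a zero    = identity s (chainLength a) j
    where
    identity : ∀ s m j → s + suc (j + m) ≡ s + suc m + j
    identity = solve-∀
  zoneLength-suc a (suc c) = +-comm j (chainLength a)

  j≤zoneLength : ∀ a c → j ≤ zoneLength a c
  j≤zoneLength a zero    = ≤-trans (m≤m+n j (a * j)) (≤-trans (n≤1+n _) (m≤n+m _ s))
  j≤zoneLength a (suc c) = m≤m+n j (a * j)

  zoneOffset-monoʳ : ∀ a {c} → c < λ' → zoneOffset a (suc c) ≤ zoneOffset a λ'
  zoneOffset-monoʳ a c<λ' = +-monoʳ-≤ s (s≤s (*-monoˡ-≤ (chainLength a) c<λ'))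

  zoneValue-suc : ∀ a c → zoneValue a (suc c) ≡ zoneValue a c + j
  zoneValue-suc a c = identity a c j λ'
    where
    identity : ∀ a c j l → suc (suc (a * l + suc c) * j) ≡ suc (suc (a * l + c) * j) + j
    identity = solve-∀

  zoneValue-from-blockStart : ∀ a c → zoneValue a 0 + c * j ≡ zoneValue a c
  zoneValue-from-blockStart a c = identity a c j λ'
    where
    identity : ∀ a c j l → suc (suc (a * l + 0) * j) + c * j ≡ suc (suc (a * l + c) * j)
    identity = solve-∀

  zoneValue-next-block : ∀ a c → zoneValue (suc a) c ≡ zoneValue a c + λ' * j
  zoneValue-next-block a c = identity a c j λ'
    where
    identity : ∀ a c j l → suc (suc (suc a * l + c) * j) ≡ suc (suc (a * l + c) * j) + l * j
    identity = solve-∀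

  zoneValue-last : ∀ a → zoneValue a λ' ≡ zoneValue (suc a) 0
  zoneValue-last a = cong (λ k → suc (suc k * j)) (trans (+-comm (a * λ') λ') (sym (+-identityʳ _)))

  -- The shift n ↦ n - s - w(n - j) of the recursion carries zone (a + 1 , c) onto zone (a , c).
  zoneStart-shift : ∀ a c → zoneStart (suc a) c + j ≡ zoneStart a c + s + zoneValue (suc a) c
  zoneStart-shift a zero    = identity (blockStart a) a s j λ'
    where
    identity : ∀ B a s j l →
      B + (s + suc (l * (suc a * j))) + 0 + j ≡ B + 0 + s + suc (suc (suc a * l + 0) * j)
    identity = solve-∀
  zoneStart-shift a (suc c) = identity (blockStart a) a c s j λ'
    where
    identity : ∀ B a c s j l →
      B + (s + suc (l * (suc a * j))) + (s + suc (suc c * (suc (suc a) * j))) + j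
        ≡ B + (s + suc (suc c * (suc a * j))) + s + suc (suc (suc a * l + suc c) * j)
    identity = solve-∀

  a<blockStart : ∀ a → a < blockStart a
  a<blockStart zero    = ≤-trans (s≤s z≤n) (m≤n+m 2 s)
  a<blockStart (suc a) = ≤-<-trans (a<blockStart a)
    (m<m+n (blockStart a) (≤-trans (s≤s z≤n) (m≤n+m (suc (λ' * chainLength a)) s)))

  N₀≡blockStart1 : N₀ j s λ' ≡ blockStart 1
  N₀≡blockStart1 = identity s j λ'
    where
    identity : ∀ s j l → 3 + 2 * s + l * j ≡ s + 2 + (s + suc (l * (1 * j)))
    identity = solve-∀

  j≤N₀ : j ≤ N₀ j s λ'
  j≤N₀ = ≤-trans (m≤n*m j λ') (m≤n+m (λ' * j) (3 + 2 * s))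

  zone-offset : ∀ a c {x} → zoneStart a c ≤ x → x < zoneStart a (suc c) →
    ∃[ r ] (r < zoneLength a c × zoneStart a c + r ≡ x)
  zone-offset a c Z≤x x<Z′ with r , refl ← m≤n⇒∃[o]m+o≡n Z≤x =
    r , +-cancelˡ-< (zoneStart a c) r _ (subst (zoneStart a c + r <_) (zoneStart-suc a c) x<Z′) , refl

  zone-covering : ∀ {n} → blockStart 1 ≤ n →
    ∃[ a ] ∃[ c ] (c < λ' × ∃[ d ] (d < zoneLength (suc a) c × zoneStart (suc a) c + d ≡ n))
  zone-covering {n} B₁≤n
    with bracketing (λ a → blockStart (suc a)) n B₁≤n (<-trans (n<1+n n) (a<blockStart (suc n)))
  ... | a , _ , Bₐ≤n , n<Bₐ₊₁
    with bracketing (zoneStart (suc a)) λ' (subst (_≤ n) (sym (+-identityʳ _)) Bₐ≤n) n<Bₐ₊₁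
  ... | c , c<λ' , Z≤n , n<Z′ = a , c , c<λ' , zone-offset (suc a) c Z≤n n<Z′

  length-chain : ∀ m → length (chain m) ≡ m
  length-chain zero    = refl
  length-chain (suc k) =
    trans (length-++ (replicate k chainInner)) (trans (cong (_+ 1) (length-replicate k)) (+-comm k 1))

  totalWeight-chain : ∀ k → totalWeight (chain (suc k)) ≡ j
  totalWeight-chain k =
    trans (totalWeight-replicate-++ k chainInner [ chainBottom ]) (cong₂ _+_ (*-zeroʳ k) (+-identityʳ j))

  prefixWeight-chain : ∀ k {r} → r ≤ k → prefixWeight (chain (suc k)) r ≡ 0
  prefixWeight-chain k {r} r≤k =
    trans (prefixWeight-replicate-++ˡ k chainInner [ chainBottom ] r≤k) (*-zeroʳ r)

  chains : ℕ → List NodeKind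
  chains a = concat (replicate λ' (chain (chainLength a)))

  length-block : ∀ a → length (block a) ≡ zoneOffset a λ'
  length-block a = begin
    length (replicate s supernode ++ knot ∷ chains a)
      ≡⟨ length-++ (replicate s supernode) ⟩
    length (replicate s supernode) + suc (length (chains a))
      ≡⟨ cong₂ (λ x y → x + suc y) (length-replicate s) (length-concat-replicate λ' (chain m)) ⟩
    s + suc (λ' * length (chain m))
      ≡⟨ cong (λ ℓ → s + suc (λ' * ℓ)) (length-chain m) ⟩
    zoneOffset a λ' ∎
    where
    m = chainLength a

  totalWeight-block : ∀ a → totalWeight (block a) ≡ λ' * j
  totalWeight-block a = begin
    totalWeight (replicate s supernode ++ knot ∷ chains a)
      ≡⟨ totalWeight-replicate-++ s supernode (knot ∷ chains a) ⟩
    s * 0 + totalWeight (chains a)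
      ≡⟨ cong₂ _+_ (*-zeroʳ s) (totalWeight-concat-replicate λ' (chain (chainLength a))) ⟩
    λ' * totalWeight (chain (chainLength a))
      ≡⟨ cong (λ' *_) (totalWeight-chain (j-1 + a * j)) ⟩
    λ' * j ∎

  prefixWeight-block-header : ∀ a {t} → t ≤ s → prefixWeight (block a) t ≡ 0
  prefixWeight-block-header a {t} t≤s = trans (prefixWeight-replicate-++ˡ s supernode _ t≤s) (*-zeroʳ t)

  prefixWeight-block-chains : ∀ a {c r} → c < λ' → r < chainLength a →
    prefixWeight (block a) (s + suc (c * chainLength a + r)) ≡ c * j
  prefixWeight-block-chains a {c} {r} c<λ' r<m = begin
    prefixWeight (replicate s supernode ++ knot ∷ chains a) (s + suc (c * m + r))
      ≡⟨ prefixWeight-replicate-++ʳ s supernode (knot ∷ chains a) _ ⟩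
    s * 0 + prefixWeight (chains a) (c * m + r)
      ≡⟨ cong₂ _+_ (*-zeroʳ s) (cong (λ ℓ → prefixWeight (chains a) (c * ℓ + r)) (sym (length-chain m))) ⟩
    prefixWeight (chains a) (c * length (chain m) + r)
      ≡⟨ prefixWeight-concat-replicate (chain m) c<λ' (subst (r ≤_) (sym (length-chain m)) (<⇒≤ r<m)) ⟩
    c * totalWeight (chain m) + prefixWeight (chain m) r
      ≡⟨ cong₂ _+_ (cong (c *_) (totalWeight-chain (j-1 + a * j)))
                   (prefixWeight-chain (j-1 + a * j) (≤-pred r<m)) ⟩
    c * j + 0
      ≡⟨ +-identityʳ (c * j) ⟩
    c * j ∎
    where
    m = chainLength a

  prefixWeight-block : ∀ a c {r} → c < λ' → r < zoneLength a c →
    prefixWeight (block a) (zoneOffset a c + r) ≡ c * j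
  prefixWeight-block a zero {r} _ r<ℓ with r ≤? s
  ... | yes r≤s = prefixWeight-block-header a r≤s
  ... | no  r≰s with o , refl ← m≤n⇒∃[o]m+o≡n (≰⇒> r≰s) =
    trans (cong (prefixWeight (block a)) (sym (+-suc s o))) (prefixWeight-block-chains a (s≤s z≤n) o<m)
    where
    o<m : o < chainLength a
    o<m = ≤-pred (+-cancelˡ-< s (suc o) _ (subst (_< s + suc (chainLength a)) (sym (+-suc s o)) r<ℓ))
  prefixWeight-block a (suc c) {r} c<λ' r<m =
    trans (cong (prefixWeight (block a)) (+-assoc s (suc (suc c * chainLength a)) r))
      (prefixWeight-block-chains a c<λ' r<m)

  length-labels0 : length (labels0 s) ≡ s + 2
  length-labels0 = trans
    (cong suc (trans (length-++ (replicate s supernode)) (cong (_+ 1) (length-replicate s))))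
    (sym (+-suc s 1))

  totalWeight-labels0 : totalWeight (labels0 s) ≡ suc j
  totalWeight-labels0 =
    cong suc (trans (totalWeight-replicate-++ s supernode [ leafL0 ]) (cong₂ _+_ (*-zeroʳ s) (+-identityʳ j)))

  length-blocks : ∀ a → length (labels0 s) + length (blocks a) ≡ blockStart a
  length-blocks zero    = trans (+-identityʳ _) length-labels0
  length-blocks (suc a) = begin
    length (labels0 s) + length (blocks (suc a))
      ≡⟨ cong (λ xs → length (labels0 s) + length xs) (concat-applyUpTo-suc block a) ⟩
    length (labels0 s) + length (blocks a ++ block a)
      ≡⟨ cong (length (labels0 s) +_) (length-++ (blocks a)) ⟩
    length (labels0 s) + (length (blocks a) + length (block a))
      ≡⟨ +-assoc (length (labels0 s)) _ _ ⟨
    length (labels0 s) + length (blocks a) + length (block a)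
      ≡⟨ cong₂ _+_ (length-blocks a) (length-block a) ⟩
    blockStart (suc a) ∎

  totalWeight-blocks : ∀ a → totalWeight (labels0 s) + totalWeight (blocks a) ≡ zoneValue a 0
  totalWeight-blocks zero    =
    trans (+-identityʳ _) (trans totalWeight-labels0 (cong suc (sym (+-identityʳ j))))
  totalWeight-blocks (suc a) = begin
    totalWeight (labels0 s) + totalWeight (blocks (suc a))
      ≡⟨ cong (λ xs → totalWeight (labels0 s) + totalWeight xs) (concat-applyUpTo-suc block a) ⟩
    totalWeight (labels0 s) + totalWeight (blocks a ++ block a)
      ≡⟨ cong (totalWeight (labels0 s) +_) (totalWeight-++ (blocks a) (block a)) ⟩
    totalWeight (labels0 s) + (totalWeight (blocks a) + totalWeight (block a))
      ≡⟨ +-assoc (totalWeight (labels0 s)) _ _ ⟨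
    totalWeight (labels0 s) + totalWeight (blocks a) + totalWeight (block a)
      ≡⟨ cong₂ _+_ (totalWeight-blocks a) (totalWeight-block a) ⟩
    zoneValue a 0 + λ' * j
      ≡⟨ zoneValue-next-block a 0 ⟨
    zoneValue (suc a) 0 ∎

  w-within-block : ∀ a {t} → t ≤ length (block a) →
    w j s λ' (blockStart a + t) ≡ zoneValue a 0 + prefixWeight (block a) t
  w-within-block a {t} t≤ = begin
    prefixWeight (labels0 s ++ blocks x) x
      ≡⟨ cong (prefixWeight (labels0 s ++ blocks x)) x≡ ⟩
    prefixWeight (labels0 s ++ blocks x) (length (labels0 s) + (length (blocks a) + t))
      ≡⟨ prefixWeight-++ʳ (labels0 s) (blocks x) _ ⟩
    totalWeight (labels0 s) + prefixWeight (blocks x) (length (blocks a) + t)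
      ≡⟨ cong (totalWeight (labels0 s) +_) (prefixWeight-concat-applyUpTo block a<x t≤) ⟩
    totalWeight (labels0 s) + (totalWeight (blocks a) + prefixWeight (block a) t)
      ≡⟨ +-assoc (totalWeight (labels0 s)) _ _ ⟨
    totalWeight (labels0 s) + totalWeight (blocks a) + prefixWeight (block a) t
      ≡⟨ cong (_+ prefixWeight (block a) t) (totalWeight-blocks a) ⟩
    zoneValue a 0 + prefixWeight (block a) t ∎
    where
    x = blockStart a + t
    x≡ : x ≡ length (labels0 s) + (length (blocks a) + t)
    x≡ = trans (cong (_+ t) (sym (length-blocks a))) (+-assoc (length (labels0 s)) _ t)
    a<x : a < x
    a<x = <-≤-trans (a<blockStart a) (m≤m+n (blockStart a) t)

  w-on-zone : ∀ a c {r} → c < λ' → r < zoneLength a c → w j s λ' (zoneStart a c + r) ≡ zoneValue a c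
  w-on-zone a c {r} c<λ' r<ℓ = begin
    w j s λ' (zoneStart a c + r)
      ≡⟨ cong (w j s λ') (+-assoc (blockStart a) (zoneOffset a c) r) ⟩
    w j s λ' (blockStart a + (zoneOffset a c + r))
      ≡⟨ w-within-block a t≤ ⟩
    zoneValue a 0 + prefixWeight (block a) (zoneOffset a c + r)
      ≡⟨ cong (zoneValue a 0 +_) (prefixWeight-block a c c<λ' r<ℓ) ⟩
    zoneValue a 0 + c * j
      ≡⟨ zoneValue-from-blockStart a c ⟩
    zoneValue a c ∎
    where
    t≤ : zoneOffset a c + r ≤ length (block a)
    t≤ = ≤-trans (<⇒≤ (+-monoʳ-< (zoneOffset a c) r<ℓ))
           (≤-trans (≤-reflexive (sym (zoneOffset-suc a c)))
             (≤-trans (zoneOffset-monoʳ a c<λ') (≤-reflexive (sym (length-block a)))))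

  w-before-next-zone : ∀ a c {x} → c < λ' → x < zoneStart a (suc c) → zoneStart a (suc c) ≤ x + j →
    w j s λ' x + j ≡ zoneValue a (suc c)
  w-before-next-zone a c {x} c<λ' x<Z′ Z′≤x+j
    with zone-offset a c
           (+-cancelʳ-≤ j (zoneStart a c) x
             (≤-trans (+-monoʳ-≤ (zoneStart a c) (j≤zoneLength a c))
               (subst (_≤ x + j) (zoneStart-suc a c) Z′≤x+j)))
           x<Z′
  ... | r , r<ℓ , refl = trans (cong (_+ j) (w-on-zone a c c<λ' r<ℓ)) (sym (zoneValue-suc a c))

  w-before-zone : ∀ a c {x} → c < λ' → x < zoneStart (suc a) c → zoneStart (suc a) c ≤ x + j →
    w j s λ' x + j ≡ zoneValue (suc a) c
  w-before-zone a (suc c) c<λ' = w-before-next-zone (suc a) c (<-trans (n<1+n c) c<λ')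
  w-before-zone a zero {x} _ x<Z Z≤x+j =
    trans (w-before-next-zone a λ-1 (n<1+n λ-1)
             (subst (x <_) (sym (zoneStart-last a)) x<Z)
             (subst (_≤ x + j) (sym (zoneStart-last a)) Z≤x+j))
          (zoneValue-last a)

  shift-into-zone : ∀ a c {e W n} → c < λ' → e < zoneLength a c →
    zoneStart a c + e + (s + W) ≡ n → w j s λ' n ≡ zoneValue (suc a) c →
    ∃[ m ] (1 ≤ m × m + (s + W) ≡ n × w j s λ' m + λ' * j ≡ w j s λ' n)
  shift-into-zone a c {e} c<λ' e<ℓ m+s+W≡n wn =
    zoneStart a c + e ,
    ≤-trans (≤-trans (s≤s z≤n) (a<blockStart a)) (≤-trans (m≤m+n _ _) (m≤m+n _ e)) ,
    m+s+W≡n ,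
    trans (cong (_+ λ' * j) (w-on-zone a c c<λ' e<ℓ)) (trans (sym (zoneValue-next-block a c)) (sym wn))

  Shift : ℕ → Set
  Shift n = ∃[ m ] (1 ≤ m × m + (s + w j s λ' (n ∸ j)) ≡ n × w j s λ' m + λ' * j ≡ w j s λ' n)

  w-shift-in-zone : ∀ a c d → c < λ' → d < zoneLength (suc a) c →
    blockStart 1 ≤ zoneStart (suc a) c + d → Shift (zoneStart (suc a) c + d)
  w-shift-in-zone a c d c<λ' d<ℓ B₁≤n with j ≤? d
  ... | yes j≤d with e , refl ← m≤n⇒∃[o]m+o≡n j≤d =
    shift-into-zone a c c<λ' e<ℓ m+s+W≡n (w-on-zone (suc a) c c<λ' d<ℓ)
    where
    Z′ = zoneStart (suc a) c
    e<ℓ : e < zoneLength a c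
    e<ℓ = +-cancelʳ-< j e _ (subst₂ _<_ (+-comm j e) (zoneLength-suc a c) d<ℓ)
    n∸j≡ : Z′ + (j + e) ∸ j ≡ Z′ + e
    n∸j≡ = trans (cong (λ y → Z′ + y ∸ j) (+-comm j e))
             (trans (cong (_∸ j) (sym (+-assoc Z′ e j))) (m+n∸n≡m (Z′ + e) j))
    W≡ : w j s λ' (Z′ + (j + e) ∸ j) ≡ zoneValue (suc a) c
    W≡ = trans (cong (w j s λ') n∸j≡) (w-on-zone (suc a) c c<λ' (≤-<-trans (m≤n+m e j) d<ℓ))
    rearrange : ∀ A e s V → A + e + (s + V) ≡ A + s + V + e
    rearrange = solve-∀
    m+s+W≡n : zoneStart a c + e + (s + w j s λ' (Z′ + (j + e) ∸ j)) ≡ Z′ + (j + e)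
    m+s+W≡n = begin
      zoneStart a c + e + (s + w j s λ' (Z′ + (j + e) ∸ j))
        ≡⟨ cong (λ y → zoneStart a c + e + (s + y)) W≡ ⟩
      zoneStart a c + e + (s + zoneValue (suc a) c)
        ≡⟨ rearrange (zoneStart a c) e s (zoneValue (suc a) c) ⟩
      zoneStart a c + s + zoneValue (suc a) c + e
        ≡⟨ cong (_+ e) (zoneStart-shift a c) ⟨
      Z′ + j + e
        ≡⟨ +-assoc Z′ j e ⟩
      Z′ + (j + e) ∎
  ... | no j≰d = shift-into-zone a c c<λ' d<ℓ′ m+s+W≡n (w-on-zone (suc a) c c<λ' d<ℓ)
    where
    Z′ = zoneStart (suc a) c
    d<j : d < j
    d<j = ≰⇒> j≰d
    d<ℓ′ : d < zoneLength a c
    d<ℓ′ = <-≤-trans d<j (j≤zoneLength a c)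
    x = Z′ + d ∸ j
    x+j≡n : x + j ≡ Z′ + d
    x+j≡n = m∸n+n≡m (≤-trans (subst (j ≤_) N₀≡blockStart1 j≤N₀) B₁≤n)
    W+j≡ : w j s λ' x + j ≡ zoneValue (suc a) c
    W+j≡ = w-before-zone a c c<λ'
      (+-cancelʳ-< j x Z′ (subst (_< Z′ + j) (sym x+j≡n) (+-monoʳ-< Z′ d<j)))
      (subst (Z′ ≤_) (sym x+j≡n) (m≤m+n Z′ d))
    rearrange : ∀ A d s W j → A + d + (s + W) + j ≡ A + s + (W + j) + d
    rearrange = solve-∀
    rearrange′ : ∀ Z j d → Z + j + d ≡ Z + d + j
    rearrange′ = solve-∀
    m+s+W≡n : zoneStart a c + d + (s + w j s λ' x) ≡ Z′ + d
    m+s+W≡n = +-cancelʳ-≡ j _ _ (begin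
      zoneStart a c + d + (s + w j s λ' x) + j
        ≡⟨ rearrange (zoneStart a c) d s (w j s λ' x) j ⟩
      zoneStart a c + s + (w j s λ' x + j) + d
        ≡⟨ cong (λ y → zoneStart a c + s + y + d) W+j≡ ⟩
      zoneStart a c + s + zoneValue (suc a) c + d
        ≡⟨ cong (_+ d) (zoneStart-shift a c) ⟨
      Z′ + j + d
        ≡⟨ rearrange′ Z′ j d ⟩
      Z′ + d + j ∎)

  w-shift : ∀ {n} → blockStart 1 ≤ n → Shift n
  w-shift B₁≤n =
    let a , c , c<λ' , d , d<ℓ , Z+d≡n = zone-covering B₁≤n
    in subst Shift Z+d≡n
         (w-shift-in-zone a c d c<λ' d<ℓ (subst (blockStart 1 ≤_) (sym Z+d≡n) B₁≤n))

  Shift⇒recursion : ∀ {n} → Shift n →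
    w j s λ' n ≡ w j s λ' (n ∸ s ∸ w j s λ' (n ∸ j)) + λ' * j
  Shift⇒recursion {n} (m , _ , m+sW≡n , wm+λj≡wn) = begin
    w j s λ' n                                   ≡⟨ wm+λj≡wn ⟨
    w j s λ' m + λ' * j                          ≡⟨ cong (λ y → w j s λ' y + λ' * j) n∸s∸W≡m ⟨
    w j s λ' (n ∸ s ∸ w j s λ' (n ∸ j)) + λ' * j ∎
    where
    sW = s + w j s λ' (n ∸ j)
    n∸s∸W≡m : n ∸ s ∸ w j s λ' (n ∸ j) ≡ m
    n∸s∸W≡m = trans (∸-+-assoc n s _) (trans (cong (_∸ sW) (sym m+sW≡n)) (m+n∸n≡m m sW))

  Shift⇒argument< : ∀ {n} → Shift n → s + w j s λ' (n ∸ j) < n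
  Shift⇒argument< {n} (m , 1≤m , m+sW≡n , _) =
    subst (s + w j s λ' (n ∸ j) <_) m+sW≡n (m<n+m _ 1≤m)

  N₀<n⇒blockStart1≤n : ∀ {n} → N₀ j s λ' < n → blockStart 1 ≤ n
  N₀<n⇒blockStart1≤n {n} N₀<n = subst (_≤ n) N₀≡blockStart1 (<⇒≤ N₀<n)

  w-recursion : ∀ n → N₀ j s λ' < n →
    w j s λ' n ≡ w j s λ' (n ∸ s ∸ w j s λ' (n ∸ j)) + λ' * j
  w-recursion n N₀<n = Shift⇒recursion (w-shift (N₀<n⇒blockStart1≤n N₀<n))

  w-argument< : ∀ n → N₀ j s λ' < n → s + w j s λ' (n ∸ j) < n
  w-argument< n N₀<n = Shift⇒argument< (w-shift (N₀<n⇒blockStart1≤n N₀<n))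

theorem1 : (j s λ' : ℕ) → 1 ≤ j → 1 ≤ λ' →
    (g : ℕ → ℕ) →
    (∀ n → 1 ≤ n → n ≤ N₀ j s λ' → g n ≡ w j s λ' n) →
    (∀ n → N₀ j s λ' < n → g n ≡ g (n ∸ s ∸ g (n ∸ j)) + λ' * j) →
    (∀ n → N₀ j s λ' < n → (1 ≤ n ∸ j) × (s + g (n ∸ j) < n) × (1 ≤ s + g (n ∸ j)))
    × (∀ n → 1 ≤ n → g n ≡ w j s λ' n)
theorem1 (suc j-1) s (suc λ-1) _ _ g g-initial g-rec = g-arguments , g≡w
  where
  open Tree j-1 s λ-1

  g≡w : ∀ n → 1 ≤ n → g n ≡ w j s λ' n
  g≡w = nestedRecursion-unique g (w j s λ') (s≤s z≤n) j≤N₀ (w-positive j s λ') w-argument<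
          g-initial g-rec w-recursion

  g-arguments : ∀ n → N₀ j s λ' < n →
    (1 ≤ n ∸ j) × (s + g (n ∸ j) < n) × (1 ≤ s + g (n ∸ j))
  g-arguments n N₀<n =
    1≤n∸j ,
    subst (λ y → s + y < n) (sym g≡w[n∸j]) (w-argument< n N₀<n) ,
    subst (λ y → 1 ≤ s + y) (sym g≡w[n∸j])
      (≤-trans (w-positive j s λ' (n ∸ j) 1≤n∸j) (m≤n+m _ s))
    where
    1≤n∸j : 1 ≤ n ∸ j
    1≤n∸j = m<n⇒0<n∸m (≤-<-trans j≤N₀ N₀<n)
    g≡w[n∸j] : g (n ∸ j) ≡ w j s λ' (n ∸ j)
    g≡w[n∸j] = g≡w (n ∸ j) 1≤n∸j
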